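{- Let $X$ be a finite nonempty set and let $Q$ be a quintet system in $X$ which is thin, transitive and saturated. Then there do not exist $a,b,c,d,x,y\in X$ such that $(a,b\,|\,c,x\,|\,d)\in Q$ and at least one of the following also belongs to $Q$: (B) $(a,c\,|\,b,d\,|\,y)$; (C) $(a,c\,|\,d,y\,|\,b)$; (D) $(b,d\,|\,c,y\,|\,a)$; (E) $(y,c\,|\,a,b,d)$; (F) $(a,c\,|\,b,d,y)$; (G) $(a,d\,|\,b,c,y)$; (H) $(d,y\,|\,a,b,c)$.
   Context: A quintet in $X$ is a partition of a $5$-element subset of $X$ whose block sizes are $(2,2,1)$, $(3,2)$ or $(5)$. For pairwise distinct $a,b,c,d,e\in X$ write $(a,b\,|\,c,d\,|\,e)$ for the partition $\{\{a,b\},\{c,d\},\{e\}\}$, $(a,b\,|\,c,d,e)$ for $\{\{a,b\},\{c,d,e\}\}$, and $(a,b,c,d,e)$ for $\{\{a,b,c,d,e\}\}$ (order inside blocks and order of blocks of equal size are irrelevant). A quintet system in $X$ is a set $Q$ of quintets in $X$. Write $(a_1,a_2\,|\,\overline{b_1,b_2,b_3})$ for the statement that at least one of $(a_1,a_2\,|\,b_1,b_2,b_3)$, $(a_1,a_2\,|\,b_1,b_2\,|\,b_3)$, $(a_1,a_2\,|\,b_1,b_3\,|\,b_2)$, $(a_1,a_2\,|\,b_2,b_3\,|\,b_1)$ belongs to $Q$. In each condition below, "$P$" means $P\in Q$, and the condition is required for every choice of the letters (elements of $X$) such that all letters occurring in that condition are pairwise distinct. $Q$ is saturated if: (i) $(a_1,a_2|b_1,b_2|c)\Rightarrow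 (a_1,a_2|b_1,b_2|x)\vee(a_1,x|b_1,b_2|c)\vee(a_1,a_2|b_1,x|c)$; (ii) $(a_1,a_2|b_1,b_2,b_3)\Rightarrow (a_1,x|b_1,b_2,b_3)\vee(a_1,a_2|\overline{b_1,b_2,x})$; (iii) $(a_1,a_2,a_3,a_4,a_5)\Rightarrow (a_1,a_2,a_3,a_4,x)\vee(a_1,x|a_2,a_3,a_4)\vee(a_2,x|a_1,a_3,a_4)\vee(a_3,x|a_1,a_2,a_4)\vee(a_4,x|a_1,a_2,a_3)$. $Q$ is transitive if: (i) $(a_1,a_2|b_1,x|c_1)\wedge(a_1,a_2|b_1,x|c_2)\Rightarrow(a_1,a_2|\overline{c_1,c_2,b_1})$; (ii) $(a_1,a_2|b_1,x|c_1)\wedge(a_1,a_2|b_2,x|c_1)\Rightarrow(a_1,a_2|b_1,b_2|c_1)$; (iii) $(a_1,x|b_1,b_2,b_3)\wedge(a_2,x|b_1,b_2,b_3)\Rightarrow(a_1,a_2|b_1,b_2,b_3)$; (iv) $(a_1,a_2|b_1,b_3,x)\wedge(a_1,a_2|b_2,b_3,x)\Rightarrow(a_1,a_2|b_1,b_2,b_3)\vee(a_1,a_2|b_1,b_2|b_3)$; (v) $(a_1,a_2|b_1,x,b_2)\wedge(a_1,a_2|b_1,x|b_3)\Rightarrow(a_1,a_2|b_1,b_2|b_3)$; (vi) $(a_1,a_2|b_1,b_2|x)\wedge(a_1,a_2|b_1,b_3,x)\Rightarrow(a_1,a_2|b_1,b_2|b_3)$. $Q$ is thin if for every $5$-subset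 $Y$ of $X$ exactly one quintet on $Y$ belongs to $Q$, and none of the following occurs: (i) $(a,b|c,x|d)\wedge(a,c|b,y|d)$; (ii) $(a,b|c,d,x)\wedge(a,y|b,c,d)$; (iii) $(a,b|c,x|d)\wedge(a,c,d|b,y)$; (iv) $(a,x|b,c,d)\wedge(a,d|b,c|y)$. -}

module Defs where

open import Data.Nat using (ℕ; suc)
open import Data.Fin using (Fin)
open import Data.List using (List; []; _∷_)
open import Data.List.Membership.Propositional using (_∈_)
open import Data.List.Relation.Unary.AllPairs using (AllPairs)
open import Data.Product using (_×_; Σ; ∃)
open import Data.Sum using (_⊎_)
open import Function.Bundles using (_⇔_)
open import Relation.Binary.PropositionalEquality using (_≡_; _≢_)
open import Relation.Nullary using (¬_)

-- Raw representations (written notations) of quintets in X.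
--   r221 a b c d e  stands for  (a,b | c,d | e)
--   r32  a b c d e  stands for  (a,b | c,d,e)
--   r5   a b c d e  stands for  (a,b,c,d,e)
-- Two representations denote the same partition iff they have the same
-- support and the same "lie in a common block" relation (_≈Q_ below).

data Raw (X : Set) : Set where
  r221 r32 r5 : X → X → X → X → X → Raw X

module _ {X : Set} where

  elems : Raw X → List X
  elems (r221 a b c d e) = a ∷ b ∷ c ∷ d ∷ e ∷ []
  elems (r32  a b c d e) = a ∷ b ∷ c ∷ d ∷ e ∷ []
  elems (r5   a b c d e) = a ∷ b ∷ c ∷ d ∷ e ∷ []

  Valid : Raw X → Set
  Valid r = AllPairs _≢_ (elems r)

  SameBlock : Raw X → X → X → Set
  SameBlock (r221 a b c d e) u v =
    (u ∈ a ∷ b ∷ [] × v ∈ a ∷ b ∷ []) ⊎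
    (u ∈ c ∷ d ∷ [] × v ∈ c ∷ d ∷ []) ⊎ (u ≡ e × v ≡ e)
  SameBlock (r32 a b c d e) u v =
    (u ∈ a ∷ b ∷ [] × v ∈ a ∷ b ∷ []) ⊎
    (u ∈ c ∷ d ∷ e ∷ [] × v ∈ c ∷ d ∷ e ∷ [])
  SameBlock (r5 a b c d e) u v =
    u ∈ a ∷ b ∷ c ∷ d ∷ e ∷ [] × v ∈ a ∷ b ∷ c ∷ d ∷ e ∷ []

  SameSupport : Raw X → Raw X → Set
  SameSupport r s = ∀ u → (u ∈ elems r) ⇔ (u ∈ elems s)

  _≈Q_ : Raw X → Raw X → Set
  r ≈Q s = SameSupport r s × (∀ u v → SameBlock r u v ⇔ SameBlock s u v)

  -- A quintet system: a set of quintets, given as a predicate on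
  -- representations that holds only of valid ones and is independent
  -- of the chosen representation.
  record QuintetSystem : Set₁ where
    field
      Q       : Raw X → Set
      valid   : ∀ {r} → Q r → Valid r
      respect : ∀ {r s} → Q r → r ≈Q s → Valid s → Q s

  Distinct : List X → Set
  Distinct = AllPairs _≢_

  module _ (S : QuintetSystem) where
    open QuintetSystem S

    P221 P32 P5 : X → X → X → X → X → Set
    P221 a b c d e = Q (r221 a b c d e)
    P32  a b c d e = Q (r32 a b c d e)
    P5   a b c d e = Q (r5 a b c d e)

    Bar : X → X → X → X → X → Set
    Bar a1 a2 b1 b2 b3 =
      P32 a1 a2 b1 b2 b3 ⊎ P221 a1 a2 b1 b2 b3 ⊎
      P221 a1 a2 b1 b3 b2 ⊎ P221 a1 a2 b2 b3 b1

    record Saturated : Set where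
      field
        sat1 : ∀ a1 a2 b1 b2 c x → Distinct (a1 ∷ a2 ∷ b1 ∷ b2 ∷ c ∷ x ∷ []) →
          P221 a1 a2 b1 b2 c →
          P221 a1 a2 b1 b2 x ⊎ P221 a1 x b1 b2 c ⊎ P221 a1 a2 b1 x c
        sat2 : ∀ a1 a2 b1 b2 b3 x → Distinct (a1 ∷ a2 ∷ b1 ∷ b2 ∷ b3 ∷ x ∷ []) →
          P32 a1 a2 b1 b2 b3 →
          P32 a1 x b1 b2 b3 ⊎ Bar a1 a2 b1 b2 x
        sat3 : ∀ a1 a2 a3 a4 a5 x → Distinct (a1 ∷ a2 ∷ a3 ∷ a4 ∷ a5 ∷ x ∷ []) →
          P5 a1 a2 a3 a4 a5 →
          P5 a1 a2 a3 a4 x ⊎ P32 a1 x a2 a3 a4 ⊎ P32 a2 x a1 a3 a4 ⊎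
          P32 a3 x a1 a2 a4 ⊎ P32 a4 x a1 a2 a3

    record Transitive : Set where
      field
        tr1 : ∀ a1 a2 b1 x c1 c2 → Distinct (a1 ∷ a2 ∷ b1 ∷ x ∷ c1 ∷ c2 ∷ []) →
          P221 a1 a2 b1 x c1 → P221 a1 a2 b1 x c2 → Bar a1 a2 c1 c2 b1
        tr2 : ∀ a1 a2 b1 b2 x c1 → Distinct (a1 ∷ a2 ∷ b1 ∷ b2 ∷ x ∷ c1 ∷ []) →
          P221 a1 a2 b1 x c1 → P221 a1 a2 b2 x c1 → P221 a1 a2 b1 b2 c1
        tr3 : ∀ a1 a2 x b1 b2 b3 → Distinct (a1 ∷ a2 ∷ x ∷ b1 ∷ b2 ∷ b3 ∷ []) →
          P32 a1 x b1 b2 b3 → P32 a2 x b1 b2 b3 → P32 a1 a2 b1 b2 b3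
        tr4 : ∀ a1 a2 b1 b2 b3 x → Distinct (a1 ∷ a2 ∷ b1 ∷ b2 ∷ b3 ∷ x ∷ []) →
          P32 a1 a2 b1 b3 x → P32 a1 a2 b2 b3 x →
          P32 a1 a2 b1 b2 b3 ⊎ P221 a1 a2 b1 b2 b3
        tr5 : ∀ a1 a2 b1 b2 b3 x → Distinct (a1 ∷ a2 ∷ b1 ∷ b2 ∷ b3 ∷ x ∷ []) →
          P32 a1 a2 b1 x b2 → P221 a1 a2 b1 x b3 → P221 a1 a2 b1 b2 b3
        tr6 : ∀ a1 a2 b1 b2 b3 x → Distinct (a1 ∷ a2 ∷ b1 ∷ b2 ∷ b3 ∷ x ∷ []) →
          P221 a1 a2 b1 b2 x → P32 a1 a2 b1 b3 x → P221 a1 a2 b1 b2 b3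

    record Thin : Set where
      field
        exists : ∀ y1 y2 y3 y4 y5 → Distinct (y1 ∷ y2 ∷ y3 ∷ y4 ∷ y5 ∷ []) →
          Σ (Raw X) λ r → Q r × (∀ u → (u ∈ elems r) ⇔ (u ∈ y1 ∷ y2 ∷ y3 ∷ y4 ∷ y5 ∷ []))
        unique : ∀ r s → Q r → Q s → SameSupport r s → r ≈Q s
        no1 : ∀ a b c d x y → Distinct (a ∷ b ∷ c ∷ d ∷ x ∷ y ∷ []) →
          ¬ (P221 a b c x d × P221 a c b y d)
        no2 : ∀ a b c d x y → Distinct (a ∷ b ∷ c ∷ d ∷ x ∷ y ∷ []) →
          ¬ (P32 a b c d x × P32 a y b c d)
        no3 : ∀ a b c d x y → Distinct (a ∷ b ∷ c ∷ d ∷ x ∷ y ∷ []) →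
          ¬ (P221 a b c x d × P32 b y a c d)
        no4 : ∀ a b c d x y → Distinct (a ∷ b ∷ c ∷ d ∷ x ∷ y ∷ []) →
          ¬ (P32 a x b c d × P221 a d b c y)

    BtoH : X → X → X → X → X → X → Set
    BtoH a b c d x y =
      P221 a c b d y ⊎ P221 a c d y b ⊎ P221 b d c y a ⊎
      P32 y c a b d ⊎ P32 a c b d y ⊎ P32 a d b c y ⊎ P32 d y a b c

module Submission where

-- Each of the seven cases is a short chain of applications of the axioms:
-- saturation produces a disjunction of new quintets, and every alternative
-- but one is refuted because it is a *rival* of a quintet already known,
-- i.e. a different partition of the same 5-set (thinness allows only one
-- quintet per 5-set), or because it forms a pattern forbidden by thinness.

open import Defs
open import Data.Nat using (ℕ; suc)
open import Data.Fin using (Fin; zero; suc; _≟_)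
open import Data.Fin.Properties using (all?)
open import Data.List using (List; []; _∷_; map)
open import Data.List.Membership.Propositional using (_∈_)
open import Data.List.Membership.Propositional.Properties
  using (∈-map⁺; ∈-map⁻; ∈-++⁺ˡ; ∈-++⁺ʳ)
open import Data.List.Relation.Unary.Any using (here)
open import Data.List.Relation.Unary.AllPairs using (allPairs?; []; _∷_)
  renaming (map to allPairs-map)
open import Data.List.Relation.Unary.AllPairs.Properties using ()
  renaming (map⁺ to allPairs-map⁺)
open import Data.Vec using (Vec; lookup; toList) renaming (_∷_ to _∷ᵥ_; [] to []ᵥ)
open import Data.Vec.Relation.Unary.All.Properties using (toList⁻)
open import Data.Vec.Relation.Unary.Unique.Propositional using (Unique)
  renaming (_∷_ to _∷ᵤ_; [] to []ᵤ)
open import Data.Vec.Relation.Unary.Unique.Propositional.Properties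
  using (lookup-injective)
open import Data.Product using (_×_; ∃; _,_; proj₁; proj₂; uncurry)
open import Data.Sum using (_⊎_; inj₁; inj₂; [_,_]′)
import Data.Sum as Sum
open import Data.Empty using (⊥; ⊥-elim)
open import Function using (_∘_; case_of_)
open import Function.Bundles using (_⇔_; mk⇔; Equivalence)
open import Function.Definitions using (Injective)
open import Relation.Binary.PropositionalEquality using (_≡_; refl; sym; cong; subst)
open import Relation.Nullary using (¬_; Dec)
open import Relation.Nullary.Decidable
  using (True; toWitness; map′; _×-dec_; _⊎-dec_; _→-dec_; ¬?)

Rival : {X : Set} → Raw X → Raw X → Set
Rival r s = SameSupport r s × ¬ (r ≈Q s)

rivals-exclusive : {X : Set} (S : QuintetSystem {X}) → Thin S →
  ∀ {r s} → Rival r s → QuintetSystem.Q S r → QuintetSystem.Q S s → ⊥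
rivals-exclusive S th (same , different) qr qs =
  different (Thin.unique th _ _ qr qs same)

sameBlock-∈ : {X : Set} (r : Raw X) {u v : X} →
  SameBlock r u v → u ∈ elems r × v ∈ elems r
sameBlock-∈ (r221 a b c d e) (inj₁ (p , q)) = ∈-++⁺ˡ p , ∈-++⁺ˡ q
sameBlock-∈ (r221 a b c d e) (inj₂ (inj₁ (p , q))) =
  ∈-++⁺ʳ (a ∷ b ∷ []) (∈-++⁺ˡ p) , ∈-++⁺ʳ (a ∷ b ∷ []) (∈-++⁺ˡ q)
sameBlock-∈ (r221 a b c d e) (inj₂ (inj₂ (p , q))) =
  ∈-++⁺ʳ (a ∷ b ∷ c ∷ d ∷ []) (here p) , ∈-++⁺ʳ (a ∷ b ∷ c ∷ d ∷ []) (here q)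
sameBlock-∈ (r32 a b c d e) (inj₁ (p , q)) = ∈-++⁺ˡ p , ∈-++⁺ˡ q
sameBlock-∈ (r32 a b c d e) (inj₂ (p , q)) = ∈-++⁺ʳ (a ∷ b ∷ []) p , ∈-++⁺ʳ (a ∷ b ∷ []) q
sameBlock-∈ (r5 a b c d e) pq = pq

_⇔?_ : {A B : Set} → Dec A → Dec B → Dec (A ⇔ B)
a? ⇔? b? = map′ (uncurry mk⇔) (λ e → Equivalence.to e , Equivalence.from e)
                ((a? →-dec b?) ×-dec (b? →-dec a?))

module Decide {n : ℕ} where
  open import Data.List.Membership.DecPropositional (_≟_ {n}) using (_∈?_)

  distinct? : (l : List (Fin n)) → Dec (Distinct l)
  distinct? = allPairs? (λ u v → ¬? (u ≟ v))

  valid? : (r : Raw (Fin n)) → Dec (Valid r)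
  valid? r = distinct? (elems r)

  sameBlock? : (r : Raw (Fin n)) (u v : Fin n) → Dec (SameBlock r u v)
  sameBlock? (r221 a b c d e) u v =
    (u ∈? a ∷ b ∷ [] ×-dec v ∈? a ∷ b ∷ []) ⊎-dec
    (u ∈? c ∷ d ∷ [] ×-dec v ∈? c ∷ d ∷ []) ⊎-dec (u ≟ e ×-dec v ≟ e)
  sameBlock? (r32 a b c d e) u v =
    (u ∈? a ∷ b ∷ [] ×-dec v ∈? a ∷ b ∷ []) ⊎-dec
    (u ∈? c ∷ d ∷ e ∷ [] ×-dec v ∈? c ∷ d ∷ e ∷ [])
  sameBlock? (r5 a b c d e) u v =
    u ∈? a ∷ b ∷ c ∷ d ∷ e ∷ [] ×-dec v ∈? a ∷ b ∷ c ∷ d ∷ e ∷ []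

  sameSupport? : (r s : Raw (Fin n)) → Dec (SameSupport r s)
  sameSupport? r s = all? (λ u → (u ∈? elems r) ⇔? (u ∈? elems s))

  _≈Q?_ : (r s : Raw (Fin n)) → Dec (r ≈Q s)
  r ≈Q? s = sameSupport? r s ×-dec
            all? (λ u → all? (λ v → sameBlock? r u v ⇔? sameBlock? s u v))

  rival? : (r s : Raw (Fin n)) → Dec (Rival r s)
  rival? r s = sameSupport? r s ×-dec ¬? (r ≈Q? s)

module Relabel {I X : Set} (f : I → X) (f-injective : Injective _≡_ _≡_ f) where

  relabel : Raw I → Raw X
  relabel (r221 a b c d e) = r221 (f a) (f b) (f c) (f d) (f e)
  relabel (r32 a b c d e) = r32 (f a) (f b) (f c) (f d) (f e)
  relabel (r5 a b c d e) = r5 (f a) (f b) (f c) (f d) (f e)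

  elems-relabel : ∀ r → elems (relabel r) ≡ map f (elems r)
  elems-relabel (r221 a b c d e) = refl
  elems-relabel (r32 a b c d e) = refl
  elems-relabel (r5 a b c d e) = refl

  distinct-map : ∀ {l} → Distinct l → Distinct (map f l)
  distinct-map d = allPairs-map⁺ (allPairs-map (λ i≢j → i≢j ∘ f-injective) d)

  valid-relabel : ∀ r → Valid r → Valid (relabel r)
  valid-relabel r v = subst Distinct (sym (elems-relabel r)) (distinct-map v)

  ∈-map-reflect : ∀ {i l} → f i ∈ map f l → i ∈ l
  ∈-map-reflect p with ∈-map⁻ f p
  ... | j , j∈l , fi≡fj = subst (_∈ _) (sym (f-injective fi≡fj)) j∈l

  ∈-relabel⁺ : ∀ r {i} → i ∈ elems r → f i ∈ elems (relabel r)
  ∈-relabel⁺ r p rewrite elems-relabel r = ∈-map⁺ f p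

  ∈-relabel⁻ : ∀ r {i} → f i ∈ elems (relabel r) → i ∈ elems r
  ∈-relabel⁻ r p rewrite elems-relabel r = ∈-map-reflect p

  ∈-relabel-image : ∀ r {u} → u ∈ elems (relabel r) → ∃ λ i → u ≡ f i
  ∈-relabel-image r p rewrite elems-relabel r with ∈-map⁻ f p
  ... | i , _ , u≡fi = i , u≡fi

  sameBlock-relabel⁺ : ∀ r {i j} → SameBlock r i j → SameBlock (relabel r) (f i) (f j)
  sameBlock-relabel⁺ (r221 a b c d e) (inj₁ (p , q)) = inj₁ (∈-map⁺ f p , ∈-map⁺ f q)
  sameBlock-relabel⁺ (r221 a b c d e) (inj₂ (inj₁ (p , q))) =
    inj₂ (inj₁ (∈-map⁺ f p , ∈-map⁺ f q))
  sameBlock-relabel⁺ (r221 a b c d e) (inj₂ (inj₂ (p , q))) = inj₂ (inj₂ (cong f p , cong f q))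
  sameBlock-relabel⁺ (r32 a b c d e) (inj₁ (p , q)) = inj₁ (∈-map⁺ f p , ∈-map⁺ f q)
  sameBlock-relabel⁺ (r32 a b c d e) (inj₂ (p , q)) = inj₂ (∈-map⁺ f p , ∈-map⁺ f q)
  sameBlock-relabel⁺ (r5 a b c d e) (p , q) = ∈-map⁺ f p , ∈-map⁺ f q

  sameBlock-relabel⁻ : ∀ r {i j} → SameBlock (relabel r) (f i) (f j) → SameBlock r i j
  sameBlock-relabel⁻ (r221 a b c d e) (inj₁ (p , q)) = inj₁ (∈-map-reflect p , ∈-map-reflect q)
  sameBlock-relabel⁻ (r221 a b c d e) (inj₂ (inj₁ (p , q))) =
    inj₂ (inj₁ (∈-map-reflect p , ∈-map-reflect q))
  sameBlock-relabel⁻ (r221 a b c d e) (inj₂ (inj₂ (p , q))) =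
    inj₂ (inj₂ (f-injective p , f-injective q))
  sameBlock-relabel⁻ (r32 a b c d e) (inj₁ (p , q)) = inj₁ (∈-map-reflect p , ∈-map-reflect q)
  sameBlock-relabel⁻ (r32 a b c d e) (inj₂ (p , q)) = inj₂ (∈-map-reflect p , ∈-map-reflect q)
  sameBlock-relabel⁻ (r5 a b c d e) (p , q) = ∈-map-reflect p , ∈-map-reflect q

  sameSupport-relabel⁺ : ∀ r s → SameSupport r s → SameSupport (relabel r) (relabel s)
  sameSupport-relabel⁺ r s same u = mk⇔ (transfer r s same) (transfer s r same⁻¹)
    where
    same⁻¹ : SameSupport s r
    same⁻¹ i = mk⇔ (Equivalence.from (same i)) (Equivalence.to (same i))
    transfer : ∀ r s → SameSupport r s → u ∈ elems (relabel r) → u ∈ elems (relabel s)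
    transfer r s same p with ∈-relabel-image r p
    ... | i , refl = ∈-relabel⁺ s (Equivalence.to (same i) (∈-relabel⁻ r p))

  sameSupport-relabel⁻ : ∀ r s → SameSupport (relabel r) (relabel s) → SameSupport r s
  sameSupport-relabel⁻ r s same i =
    mk⇔ (∈-relabel⁻ s ∘ Equivalence.to (same (f i)) ∘ ∈-relabel⁺ r)
        (∈-relabel⁻ r ∘ Equivalence.from (same (f i)) ∘ ∈-relabel⁺ s)

  -- a block of relabel r lies in the image of f, so it comes from a block of r
  blocks-relabel⁺ : ∀ r s → (∀ i j → SameBlock r i j → SameBlock s i j) →
    ∀ u v → SameBlock (relabel r) u v → SameBlock (relabel s) u v
  blocks-relabel⁺ r s r⊆s u v p
    with ∈-relabel-image r (proj₁ (sameBlock-∈ (relabel r) p))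
       | ∈-relabel-image r (proj₂ (sameBlock-∈ (relabel r) p))
  ... | i , refl | j , refl = sameBlock-relabel⁺ s (r⊆s i j (sameBlock-relabel⁻ r p))

  ≈Q-relabel⁺ : ∀ r s → r ≈Q s → relabel r ≈Q relabel s
  ≈Q-relabel⁺ r s (same , blocks) =
    sameSupport-relabel⁺ r s same ,
    λ u v → mk⇔ (blocks-relabel⁺ r s (λ i j → Equivalence.to (blocks i j)) u v)
                (blocks-relabel⁺ s r (λ i j → Equivalence.from (blocks i j)) u v)

  ≈Q-relabel⁻ : ∀ r s → relabel r ≈Q relabel s → r ≈Q s
  ≈Q-relabel⁻ r s (same , blocks) =
    sameSupport-relabel⁻ r s same ,
    λ i j → mk⇔ (sameBlock-relabel⁻ s ∘ Equivalence.to (blocks (f i) (f j)) ∘ sameBlock-relabel⁺ r)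
                (sameBlock-relabel⁻ r ∘ Equivalence.from (blocks (f i) (f j)) ∘ sameBlock-relabel⁺ s)

  rival-relabel : ∀ r s → Rival r s → Rival (relabel r) (relabel s)
  rival-relabel r s (same , different) =
    sameSupport-relabel⁺ r s same , different ∘ ≈Q-relabel⁻ r s

lookup-distinct-injective : {X : Set} {m : ℕ} (v : Vec X m) →
  Distinct (toList v) → Injective _≡_ _≡_ (lookup v)
lookup-distinct-injective v d {i} {j} = lookup-injective (unique v d) i j
  where
  unique : ∀ {X : Set} {m} (v : Vec X m) → Distinct (toList v) → Unique v
  unique []ᵥ [] = []ᵤ
  unique (_ ∷ᵥ v) (px ∷ pv) = toList⁻ px ∷ᵤ unique v pv

A B C D X Y : Fin 6
A = zero
B = suc zero
C = suc (suc zero)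
D = suc (suc (suc zero))
X = suc (suc (suc (suc zero)))
Y = suc (suc (suc (suc (suc zero))))

-- The side conditions (that a hypothesis can be read
-- in the form the axiom requires, that the letters are distinct, that two
-- quintets are rivals) are decided by evaluation and passed implicitly.
module Labelled {T : Set} (S : QuintetSystem {T})
  (th : Thin S) (tr : Transitive S) (sa : Saturated S)
  (a b c d x y : T) (ds : Distinct (a ∷ b ∷ c ∷ d ∷ x ∷ y ∷ [])) where
  open QuintetSystem S
  open Decide

  label : Fin 6 → T
  label = lookup (a ∷ᵥ b ∷ᵥ c ∷ᵥ d ∷ᵥ x ∷ᵥ y ∷ᵥ []ᵥ)

  open Relabel label (lookup-distinct-injective _ ds)

  record ⟪_⟫ (r : Raw (Fin 6)) : Set where
    constructor holds
    field proof : Q (relabel r)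
  open ⟪_⟫

  Reads : Raw (Fin 6) → Raw (Fin 6) → Set
  Reads r s = True (r ≈Q? s ×-dec valid? s)

  Apart : List (Fin 6) → Set
  Apart l = True (distinct? l)

  as : ∀ {r} s {_ : Reads r s} → ⟪ r ⟫ → ⟪ s ⟫
  as s {ok} (holds q) = holds (respect q (≈Q-relabel⁺ _ s r≈s) (valid-relabel s valid-s))
    where r≈s = proj₁ (toWitness ok); valid-s = proj₂ (toWitness ok)

  apart : ∀ l {_ : Apart l} → Distinct (map label l)
  apart l {ok} = distinct-map (toWitness ok)

  rivals : ∀ {r s} {rival : True (rival? r s)} → ⟪ r ⟫ → ⟪ s ⟫ → ⊥
  rivals {r} {s} {rival} (holds qr) (holds qs) =
    rivals-exclusive S th (rival-relabel r s (toWitness rival)) qr qs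

  Bar′ : (a₁ a₂ b₁ b₂ b₃ : Fin 6) → Set
  Bar′ a₁ a₂ b₁ b₂ b₃ =
    ⟪ r32 a₁ a₂ b₁ b₂ b₃ ⟫ ⊎ ⟪ r221 a₁ a₂ b₁ b₂ b₃ ⟫ ⊎
    ⟪ r221 a₁ a₂ b₁ b₃ b₂ ⟫ ⊎ ⟪ r221 a₁ a₂ b₂ b₃ b₁ ⟫

  bar : ∀ {a₁ a₂ b₁ b₂ b₃} → Bar S (label a₁) (label a₂) (label b₁) (label b₂) (label b₃) →
    Bar′ a₁ a₂ b₁ b₂ b₃
  bar = Sum.map holds (Sum.map holds (Sum.map holds holds))

  bar-rivals : ∀ {a₁ a₂ b₁ b₂ b₃ s} → Bar′ a₁ a₂ b₁ b₂ b₃ → ⟪ s ⟫ →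
    {_ : True (rival? (r32 a₁ a₂ b₁ b₂ b₃) s)} {_ : True (rival? (r221 a₁ a₂ b₁ b₂ b₃) s)}
    {_ : True (rival? (r221 a₁ a₂ b₁ b₃ b₂) s)} {_ : True (rival? (r221 a₁ a₂ b₂ b₃ b₁) s)} → ⊥
  bar-rivals (inj₁ p) q {r₁} = rivals {rival = r₁} p q
  bar-rivals (inj₂ (inj₁ p)) q {_} {r₂} = rivals {rival = r₂} p q
  bar-rivals (inj₂ (inj₂ (inj₁ p))) q {_} {_} {r₃} = rivals {rival = r₃} p q
  bar-rivals (inj₂ (inj₂ (inj₂ p))) q {_} {_} {_} {r₄} = rivals {rival = r₄} p q

  sat₁ : ∀ {r} a₁ a₂ b₁ b₂ c z {_ : Reads r (r221 a₁ a₂ b₁ b₂ c)}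
    {_ : Apart (a₁ ∷ a₂ ∷ b₁ ∷ b₂ ∷ c ∷ z ∷ [])} → ⟪ r ⟫ →
    ⟪ r221 a₁ a₂ b₁ b₂ z ⟫ ⊎ ⟪ r221 a₁ z b₁ b₂ c ⟫ ⊎ ⟪ r221 a₁ a₂ b₁ z c ⟫
  sat₁ a₁ a₂ b₁ b₂ c z {ok} {ap} p =
    Sum.map holds (Sum.map holds holds)
      (Saturated.sat1 sa _ _ _ _ _ _ (apart (a₁ ∷ a₂ ∷ b₁ ∷ b₂ ∷ c ∷ z ∷ []) {ap})
        (proof (as (r221 a₁ a₂ b₁ b₂ c) {ok} p)))

  sat₂ : ∀ {r} a₁ a₂ b₁ b₂ b₃ z {_ : Reads r (r32 a₁ a₂ b₁ b₂ b₃)}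
    {_ : Apart (a₁ ∷ a₂ ∷ b₁ ∷ b₂ ∷ b₃ ∷ z ∷ [])} → ⟪ r ⟫ →
    ⟪ r32 a₁ z b₁ b₂ b₃ ⟫ ⊎ Bar′ a₁ a₂ b₁ b₂ z
  sat₂ a₁ a₂ b₁ b₂ b₃ z {ok} {ap} p =
    Sum.map holds bar
      (Saturated.sat2 sa _ _ _ _ _ _ (apart (a₁ ∷ a₂ ∷ b₁ ∷ b₂ ∷ b₃ ∷ z ∷ []) {ap})
        (proof (as (r32 a₁ a₂ b₁ b₂ b₃) {ok} p)))

  tr₁ : ∀ {r s} a₁ a₂ b₁ z c₁ c₂ {_ : Reads r (r221 a₁ a₂ b₁ z c₁)}
    {_ : Reads s (r221 a₁ a₂ b₁ z c₂)} {_ : Apart (a₁ ∷ a₂ ∷ b₁ ∷ z ∷ c₁ ∷ c₂ ∷ [])} →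
    ⟪ r ⟫ → ⟪ s ⟫ → Bar′ a₁ a₂ c₁ c₂ b₁
  tr₁ a₁ a₂ b₁ z c₁ c₂ {ok₁} {ok₂} {ap} p q =
    bar (Transitive.tr1 tr _ _ _ _ _ _ (apart (a₁ ∷ a₂ ∷ b₁ ∷ z ∷ c₁ ∷ c₂ ∷ []) {ap})
      (proof (as (r221 a₁ a₂ b₁ z c₁) {ok₁} p)) (proof (as (r221 a₁ a₂ b₁ z c₂) {ok₂} q)))

  thin₁ : ∀ {r s} a₁ b₁ c₁ d₁ x₁ y₁ {_ : Reads r (r221 a₁ b₁ c₁ x₁ d₁)}
    {_ : Reads s (r221 a₁ c₁ b₁ y₁ d₁)} {_ : Apart (a₁ ∷ b₁ ∷ c₁ ∷ d₁ ∷ x₁ ∷ y₁ ∷ [])} →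
    ⟪ r ⟫ → ⟪ s ⟫ → ⊥
  thin₁ a₁ b₁ c₁ d₁ x₁ y₁ {ok₁} {ok₂} {ap} p q =
    Thin.no1 th _ _ _ _ _ _ (apart (a₁ ∷ b₁ ∷ c₁ ∷ d₁ ∷ x₁ ∷ y₁ ∷ []) {ap})
      (proof (as (r221 a₁ b₁ c₁ x₁ d₁) {ok₁} p) , proof (as (r221 a₁ c₁ b₁ y₁ d₁) {ok₂} q))

  thin₃ : ∀ {r s} a₁ b₁ c₁ d₁ x₁ y₁ {_ : Reads r (r221 a₁ b₁ c₁ x₁ d₁)}
    {_ : Reads s (r32 b₁ y₁ a₁ c₁ d₁)} {_ : Apart (a₁ ∷ b₁ ∷ c₁ ∷ d₁ ∷ x₁ ∷ y₁ ∷ [])} →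
    ⟪ r ⟫ → ⟪ s ⟫ → ⊥
  thin₃ a₁ b₁ c₁ d₁ x₁ y₁ {ok₁} {ok₂} {ap} p q =
    Thin.no3 th _ _ _ _ _ _ (apart (a₁ ∷ b₁ ∷ c₁ ∷ d₁ ∷ x₁ ∷ y₁ ∷ []) {ap})
      (proof (as (r221 a₁ b₁ c₁ x₁ d₁) {ok₁} p) , proof (as (r32 b₁ y₁ a₁ c₁ d₁) {ok₂} q))

  thin₄ : ∀ {r s} a₁ b₁ c₁ d₁ x₁ y₁ {_ : Reads r (r32 a₁ x₁ b₁ c₁ d₁)}
    {_ : Reads s (r221 a₁ d₁ b₁ c₁ y₁)} {_ : Apart (a₁ ∷ b₁ ∷ c₁ ∷ d₁ ∷ x₁ ∷ y₁ ∷ [])} →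
    ⟪ r ⟫ → ⟪ s ⟫ → ⊥
  thin₄ a₁ b₁ c₁ d₁ x₁ y₁ {ok₁} {ok₂} {ap} p q =
    Thin.no4 th _ _ _ _ _ _ (apart (a₁ ∷ b₁ ∷ c₁ ∷ d₁ ∷ x₁ ∷ y₁ ∷ []) {ap})
      (proof (as (r32 a₁ x₁ b₁ c₁ d₁) {ok₁} p) , proof (as (r221 a₁ d₁ b₁ c₁ y₁) {ok₂} q))

  module Cases (ab∣cx∣d : ⟪ r221 A B C X D ⟫) where

    -- (B) (a,c|b,d|y): saturation makes both (a,x|b,d|y) and (b,x|a,c|y)
    -- quintets, which thin(i) forbids together.
    not-B : ⟪ r221 A C B D Y ⟫ → ⊥
    not-B ac∣bd∣y = thin₁ X A B Y D C ax∣db∣y bx∣ca∣y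
      where
      ay∣cx∣d : ⟪ r221 A Y C X D ⟫
      ay∣cx∣d = case sat₁ A B C X D Y ab∣cx∣d of λ where
        (inj₁ ab∣cx∣y) → ⊥-elim (thin₁ A B C Y X D ab∣cx∣y ac∣bd∣y)
        (inj₂ (inj₁ ay∣cx∣d)) → ay∣cx∣d
        (inj₂ (inj₂ ab∣cy∣d)) → ⊥-elim (rivals ab∣cy∣d ac∣bd∣y)

      by∣cx∣d : ⟪ r221 B Y C X D ⟫
      by∣cx∣d = case sat₁ B A C X D Y ab∣cx∣d of λ where
        (inj₁ ba∣cx∣y) → ⊥-elim (thin₁ A B C Y X D ba∣cx∣y ac∣bd∣y)
        (inj₂ (inj₁ by∣cx∣d)) → by∣cx∣d
        (inj₂ (inj₂ ba∣cy∣d)) → ⊥-elim (rivals ba∣cy∣d ac∣bd∣y)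

      ax∣db∣y : ⟪ r221 A X D B Y ⟫
      ax∣db∣y = case sat₁ A C D B Y X ac∣bd∣y of λ where
        (inj₁ ac∣db∣x) → ⊥-elim (rivals ac∣db∣x ab∣cx∣d)
        (inj₂ (inj₁ ax∣db∣y)) → ax∣db∣y
        (inj₂ (inj₂ ac∣dx∣y)) → ⊥-elim (rivals ac∣dx∣y ay∣cx∣d)

      bx∣ca∣y : ⟪ r221 B X C A Y ⟫
      bx∣ca∣y = case sat₁ B D C A Y X ac∣bd∣y of λ where
        (inj₁ bd∣ca∣x) → ⊥-elim (rivals bd∣ca∣x ab∣cx∣d)
        (inj₂ (inj₁ bx∣ca∣y)) → bx∣ca∣y
        (inj₂ (inj₂ bd∣cx∣y)) → ⊥-elim (rivals bd∣cx∣y by∣cx∣d)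

    -- (C) (a,c|d,y|b): saturation gives (a,y|c,x|d) and (c,x|d,y|b), and
    -- saturating the former by b leaves only a configuration forbidden by thin(i).
    not-C : ⟪ r221 A C D Y B ⟫ → ⊥
    not-C ac∣dy∣b = case sat₁ C X Y A D B ay∣cx∣d of λ where
        (inj₁ cx∣ya∣b) → thin₁ A C Y B D X ac∣dy∣b cx∣ya∣b
        (inj₂ (inj₁ cb∣ya∣d)) → rivals cb∣ya∣d ac∣dy∣b
        (inj₂ (inj₂ cx∣yb∣d)) → rivals cx∣yb∣d cx∣dy∣b
      where
      ay∣cx∣d : ⟪ r221 A Y C X D ⟫
      ay∣cx∣d = case sat₁ A B C X D Y ab∣cx∣d of λ where
        (inj₁ ab∣cx∣y) → ⊥-elim (bar-rivals (tr₁ A B C X D Y ab∣cx∣d ab∣cx∣y) ac∣dy∣b)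
        (inj₂ (inj₁ ay∣cx∣d)) → ay∣cx∣d
        (inj₂ (inj₂ ab∣cy∣d)) → ⊥-elim (rivals ab∣cy∣d ac∣dy∣b)

      cx∣dy∣b : ⟪ r221 C X D Y B ⟫
      cx∣dy∣b = case sat₁ C A D Y B X ac∣dy∣b of λ where
        (inj₁ ca∣dy∣x) → ⊥-elim (rivals ca∣dy∣x ay∣cx∣d)
        (inj₂ (inj₁ cx∣dy∣b)) → cx∣dy∣b
        (inj₂ (inj₂ ca∣dx∣b)) → ⊥-elim (rivals ca∣dx∣b ab∣cx∣d)

    -- (D) (b,d|c,y|a): saturation gives (a,y|c,x|d); saturating (D) by x
    -- then contradicts it, (a,b|c,x|d), or transitivity (i).
    not-D : ⟪ r221 B D C Y A ⟫ → ⊥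
    not-D bd∣cy∣a = case sat₁ C Y D B A X bd∣cy∣a of λ where
        (inj₁ cy∣db∣x) → bar-rivals (tr₁ B D C Y A X bd∣cy∣a cy∣db∣x) ab∣cx∣d
        (inj₂ (inj₁ cx∣db∣a)) → rivals cx∣db∣a ab∣cx∣d
        (inj₂ (inj₂ cy∣dx∣a)) → rivals cy∣dx∣a ay∣cx∣d
      where
      ay∣cx∣d : ⟪ r221 A Y C X D ⟫
      ay∣cx∣d = case sat₁ A B C X D Y ab∣cx∣d of λ where
        (inj₁ ab∣cx∣y) → ⊥-elim (bar-rivals (tr₁ A B C X D Y ab∣cx∣d ab∣cx∣y) bd∣cy∣a)
        (inj₂ (inj₁ ay∣cx∣d)) → ay∣cx∣d
        (inj₂ (inj₂ ab∣cy∣d)) → ⊥-elim (rivals ab∣cy∣d bd∣cy∣a)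

    -- (E) (y,c|a,b,d): each quintet produced by saturating (a,b|c,x|d) by y
    -- is contradicted by saturating (E) by x.
    not-E : ⟪ r32 Y C A B D ⟫ → ⊥
    not-E yc∣abd = case sat₁ A B C X D Y ab∣cx∣d of λ where
        (inj₁ ab∣cx∣y) → case sat₂ C Y A B D X yc∣abd of λ where
          (inj₁ cx∣abd) → rivals cx∣abd ab∣cx∣d
          (inj₂ cy∣abx‾) → bar-rivals cy∣abx‾ ab∣cx∣y
        (inj₂ (inj₁ ay∣cx∣d)) → case sat₂ C Y A D B X yc∣abd of λ where
          (inj₁ cx∣adb) → rivals cx∣adb ab∣cx∣d
          (inj₂ cy∣adx‾) → bar-rivals cy∣adx‾ ay∣cx∣d
        (inj₂ (inj₂ ab∣cy∣d)) → rivals ab∣cy∣d yc∣abd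

    -- (F) (a,c|b,d,y): saturation gives (c,x|b,d,y), which together with (F)
    -- excludes every quintet obtained by saturating (b,a|c,x|d) by y.
    not-F : ⟪ r32 A C B D Y ⟫ → ⊥
    not-F ac∣bdy = case sat₁ B A C X D Y ab∣cx∣d of λ where
        (inj₁ ba∣cx∣y) → bar-rivals (tr₁ A B C X D Y ab∣cx∣d ba∣cx∣y) ac∣bdy
        (inj₂ (inj₁ by∣cx∣d)) → rivals by∣cx∣d cx∣bdy
        (inj₂ (inj₂ ba∣cy∣d)) → rivals ba∣cy∣d ac∣bdy
      where
      cx∣bdy : ⟪ r32 C X B D Y ⟫
      cx∣bdy = case sat₂ C A B D Y X ac∣bdy of λ where
        (inj₁ cx∣bdy) → cx∣bdy
        (inj₂ ca∣bdx‾) → ⊥-elim (bar-rivals ca∣bdx‾ ab∣cx∣d)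

    -- (G) (a,d|b,c,y): saturation gives (b,y|c,x|d) and (a,x|b,c,y), which
    -- thin(iv) forbids together.
    not-G : ⟪ r32 A D B C Y ⟫ → ⊥
    not-G ad∣bcy = thin₄ X B Y C A D ax∣bcy by∣cx∣d
      where
      by∣cx∣d : ⟪ r221 B Y C X D ⟫
      by∣cx∣d = case sat₁ B A C X D Y ab∣cx∣d of λ where
        (inj₁ ba∣cx∣y) → ⊥-elim (thin₃ B A C Y X D ba∣cx∣y ad∣bcy)
        (inj₂ (inj₁ by∣cx∣d)) → by∣cx∣d
        (inj₂ (inj₂ ba∣cy∣d)) → ⊥-elim (rivals ba∣cy∣d ad∣bcy)

      ax∣bcy : ⟪ r32 A X B C Y ⟫
      ax∣bcy = case sat₂ A D B C Y X ad∣bcy of λ where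
        (inj₁ ax∣bcy) → ax∣bcy
        (inj₂ ad∣bcx‾) → ⊥-elim (bar-rivals ad∣bcx‾ ab∣cx∣d)

    -- (H) (d,y|a,b,c): saturation gives (a,y|c,x|d), and saturating (H) by x
    -- contradicts it or (a,b|c,x|d).
    not-H : ⟪ r32 D Y A B C ⟫ → ⊥
    not-H dy∣abc = case sat₂ D Y A C B X dy∣abc of λ where
        (inj₁ dx∣acb) → rivals dx∣acb ab∣cx∣d
        (inj₂ dy∣acx‾) → bar-rivals dy∣acx‾ ay∣cx∣d
      where
      ay∣cx∣d : ⟪ r221 A Y C X D ⟫
      ay∣cx∣d = case sat₁ A B C X D Y ab∣cx∣d of λ where
        (inj₁ ab∣cx∣y) → ⊥-elim (bar-rivals (tr₁ A B C X D Y ab∣cx∣d ab∣cx∣y) dy∣abc)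
        (inj₂ (inj₁ ay∣cx∣d)) → ay∣cx∣d
        (inj₂ (inj₂ ab∣cy∣d)) → ⊥-elim (rivals ab∣cy∣d dy∣abc)

lemma3p3 : (n : ℕ) (S : QuintetSystem {Fin (suc n)}) →
    Thin S → Transitive S → Saturated S →
    ¬ ∃ λ a → ∃ λ b → ∃ λ c → ∃ λ d → ∃ λ x → ∃ λ y →
      Distinct (a ∷ b ∷ c ∷ d ∷ x ∷ y ∷ []) ×
      P221 S a b c x d × BtoH S a b c d x y
lemma3p3 n S th tr sa (a , b , c , d , x , y , ds , g , h) =
  [ not-B ∘ holds , [ not-C ∘ holds , [ not-D ∘ holds , [ not-E ∘ holds ,
  [ not-F ∘ holds , [ not-G ∘ holds , not-H ∘ holds ]′ ]′ ]′ ]′ ]′ ]′ h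
  where
  open Labelled S th tr sa a b c d x y ds
  open Cases (holds g)
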